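{- Let $\mathcal{P}=(\mathcal{PV},\mathcal{L},\ell_0,\mathcal{T})$ be an integer program, let $\emptyset\neq \mathcal{T}'_{>}\subseteq\mathcal{T}'\subseteq\mathcal{T}$, let $\ell\in\mathcal{E}_{\mathcal{T}'}$ be an entry location of $\mathcal{T}'$, let $\sigma\in\Sigma$, and let $f=(f_1,\ldots,f_d)$ be an M$\Phi$RF of depth $d\geq 1$ for $\mathcal{T}'_{>}$ and $\mathcal{T}'$. Define rational constants $\gamma_1=1$ and $\gamma_i = 2+\frac{\gamma_{i-1}}{i-1}+\frac{1}{(i-1)!}$ for $i>1$, and define $$\beta = 1 + d!\cdot\gamma_d\cdot\max\{0,\sigma(f_1(\ell)),\ldots,\sigma(f_d(\ell))\}.$$ Then $\gamma_i>0$ for all $i$, $\beta$ is a positive natural number, and for every evaluation $$(\ell,\sigma)\,\big(\rightarrow^*_{\mathcal{T}'\setminus\mathcal{T}'_{>}}\circ\rightarrow_{\mathcal{T}'_{>}}\big)^n\,(\ell',\sigma')$$ with $n\geq\beta$ and every $1\leq i\leq d$, we have $\sigma'(f_i(\ell'))<0$.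
   Context: Let $\mathcal{V}$ be a set of variables. The set of constraints $\mathcal{C}(\mathcal{V})$ is the smallest set containing $e_1\leq e_2$ for all polynomials $e_1,e_2\in\mathbb{Z}[\mathcal{V}]$ and closed under conjunction ($\mathit{true}$ is the empty conjunction; $e_1<e_2$ etc. are expressed as usual over the integers). An integer program $\mathcal{P}=(\mathcal{PV},\mathcal{L},\ell_0,\mathcal{T})$ over $\mathcal{V}$ consists of a finite set $\mathcal{PV}\subseteq\mathcal{V}$ of program variables, a finite set $\mathcal{L}$ of locations with initial location $\ell_0\in\mathcal{L}$, and a finite set $\mathcal{T}$ of transitions $(\ell,\tau,\eta,\ell')$ with start location $\ell\in\mathcal{L}$, target location $\ell'\in\mathcal{L}\setminus\{\ell_0\}$, guard $\tau\in\mathcal{C}(\mathcal{V})$ and update $\eta:\mathcal{PV}\to\mathbb{Z}[\mathcal{V}]$. A state is a map $\sigma:\mathcal{V}\to\mathbb{Z}$; $\Sigma$ is the set of states; $\sigma(e)$, $\sigma(c)$ denote evaluation of expressions/constraints. An evaluation step $(\ell,\sigma)\rightarrow_t(\ell',\sigma')$ for $t=(\ell_t,\tau,\eta,\ell_t')$ holds iff $\ell=\ell_t$, $\ell'=\ell_t'$, $\sigma(\tau)=\mathit{true}$, and $\sigma'(v)=\sigma(\eta(v))$ for all $v\in\mathcal{PV}$. For a set $\mathcal{T}''$ of transitions, $\rightarrow_{\mathcal{T}''}$ is the union of $\rightarrow_t$ for $t\in\mathcal{T}''$; $\circ$ is relation composition, $^*$ reflexive-transitive closure, and $R^n$ the $n$-fold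 composition. Let $\mathbb{Z}_{\mathrm{lin}}[\mathcal{PV}]$ be the linear polynomials (degree at most 1) with integer coefficients over $\mathcal{PV}$. For $\emptyset\neq\mathcal{T}'_{>}\subseteq\mathcal{T}'\subseteq\mathcal{T}$ and $d\geq1$, a tuple $f=(f_1,\ldots,f_d)$ of functions $f_i:\mathcal{L}\to\mathbb{Z}_{\mathrm{lin}}[\mathcal{PV}]$ is an M$\Phi$RF (multiphase-linear ranking function) of depth $d$ for $\mathcal{T}'_{>}$ and $\mathcal{T}'$ if, setting $f_0(\ell)=0$ for all $\ell$, for all evaluation steps $(\ell,\sigma)\rightarrow_t(\ell',\sigma')$: (a) if $t\in\mathcal{T}'_{>}$ then $\sigma(f_{i-1}(\ell))+\sigma(f_i(\ell))\geq\sigma'(f_i(\ell'))+1$ for all $1\leq i\leq d$ and $\sigma(f_d(\ell))\geq 0$; (b) if $t\in\mathcal{T}'\setminus\mathcal{T}'_{>}$ then $\sigma(f_i(\ell))\geq\sigma'(f_i(\ell'))$ for all $1\le i\le d$. For $\emptyset\neq\mathcal{T}'\subseteq\mathcal{T}$: the entry transitions of a location $\ell$ are $\mathcal{T}_\ell=\{t\in\mathcal{T}\setminus\mathcal{T}' \mid t=(\ell'',\tau,\eta,\ell)\}$; the entry locations of $\mathcal{T}'$ are $\mathcal{E}_{\mathcal{T}'}=\{\ell_{in}\mid \mathcal{T}_{\ell_{in}}\neq\emptyset \text{ and } (\ell_{in},\tau,\eta,\ell')\in\mathcal{T}' \text{ for some } \tau,\eta,\ell'\}$. -}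

module Defs where

open import Data.Nat as ℕ using (ℕ; zero; suc; _!)
open import Data.Nat.Properties using (_!≢0)
open import Data.Integer as ℤ using (ℤ; +_; _⊔_)
open import Data.Rational as ℚ using (ℚ)
open import Data.Fin as Fin using (Fin; fromℕ; inject₁)
open import Data.List using (List; []; _∷_)
open import Data.List.Membership.Propositional using (_∈_)
open import Data.List.Relation.Unary.All using (All)
open import Data.Product using (Σ; _×_; _,_; proj₁; proj₂; ∃)
open import Relation.Nullary using (¬_)
open import Relation.Binary.PropositionalEquality using (_≡_; _≢_)
open import Relation.Binary.Construct.Closure.ReflexiveTransitive using (Star)

data Poly (V : Set) : Set where
  var   : V → Poly V
  const : ℤ → Poly V
  _⊕_   : Poly V → Poly V → Poly V
  _⊗_   : Poly V → Poly V → Poly V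
  ⊖_    : Poly V → Poly V

State : Set → Set
State V = V → ℤ

evalP : {V : Set} → State V → Poly V → ℤ
evalP σ (var v)   = σ v
evalP σ (const c) = c
evalP σ (p ⊕ q)   = evalP σ p ℤ.+ evalP σ q
evalP σ (p ⊗ q)   = evalP σ p ℤ.* evalP σ q
evalP σ (⊖ p)     = ℤ.- evalP σ p

Constraint : Set → Set
Constraint V = List (Poly V × Poly V)

Holds : {V : Set} → State V → Constraint V → Set
Holds σ c = All (λ a → evalP σ (proj₁ a) ℤ.≤ evalP σ (proj₂ a)) c

record Transition (V L : Set) : Set where
  constructor mkT
  field
    src    : L
    guard  : Constraint V
    update : V → Poly V    -- only its values on program variables matter
    tgt    : L
open Transition public

record Program (V : Set) : Set₁ where
  field
    PV     : List V
    Loc    : Set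
    Locs   : List Loc
    ℓ₀     : Loc
    ℓ₀∈    : ℓ₀ ∈ Locs
    T      : List (Transition V Loc)
    src∈   : All (λ t → src t ∈ Locs) T
    tgt∈   : All (λ t → tgt t ∈ Locs) T
    tgt≢ℓ₀ : All (λ t → tgt t ≢ ℓ₀) T
open Program public

module _ {V : Set} (P : Program V) where

  Config : Set
  Config = Loc P × State V

  Step : Transition V (Loc P) → Config → Config → Set
  Step t (ℓ , σ) (ℓ' , σ') =
    (ℓ ≡ src t) × (ℓ' ≡ tgt t) × Holds σ (guard t) ×
    (∀ v → v ∈ PV P → σ' v ≡ evalP σ (update t v))

  StepSet : (Transition V (Loc P) → Set) → Config → Config → Set
  StepSet S c c' = Σ (Transition V (Loc P)) λ t → S t × Step t c c'

  IsEntryLocation : List (Transition V (Loc P)) → Loc P → Set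
  IsEntryLocation T' ℓ =
    (Σ (Transition V (Loc P)) λ t → t ∈ T P × ¬ (t ∈ T') × tgt t ≡ ℓ) ×
    (Σ (Transition V (Loc P)) λ t → t ∈ T' × src t ≡ ℓ)

_∘ᴿ_ : {A : Set} → (A → A → Set) → (A → A → Set) → A → A → Set
(R ∘ᴿ S) x z = ∃ λ y → R x y × S y z   -- first R, then S

_^ᴿ_ : {A : Set} → (A → A → Set) → ℕ → A → A → Set
(R ^ᴿ zero)  x y = x ≡ y
(R ^ᴿ suc n) = R ∘ᴿ (R ^ᴿ n)

record LinPoly {V : Set} (PV : List V) : Set where
  field
    c₀    : ℤ
    terms : List (ℤ × V)
    inPV  : All (λ t → proj₂ t ∈ PV) terms
open LinPoly public

evalTerms : {V : Set} → State V → List (ℤ × V) → ℤ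
evalTerms σ []             = + 0
evalTerms σ ((a , v) ∷ ts) = a ℤ.* σ v ℤ.+ evalTerms σ ts

evalL : {V : Set} {PV : List V} → State V → LinPoly PV → ℤ
evalL σ p = c₀ p ℤ.+ evalTerms σ (terms p)

-- MΦRF of depth d = suc k.  Index i : Fin d stands for f_{i+1}.

module _ {V : Set} (P : Program V) where

  LinFun : ℕ → Set
  LinFun d = Fin d → Loc P → LinPoly (PV P)

  -- σ(f_{i-1}(ℓ)) where i : Fin d stands for f_{i+1}; f₀ = 0
  prevVal : {d : ℕ} → LinFun d → Fin d → Loc P → State V → ℤ
  prevVal f Fin.zero    ℓ σ = + 0
  prevVal f (Fin.suc j) ℓ σ = evalL σ (f (inject₁ j) ℓ)

  IsMΦRF : {k : ℕ} → LinFun (suc k) →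
           (T'> T' : Transition V (Loc P) → Set) → Set
  IsMΦRF {k} f T'> T' =
    ∀ (t : Transition V (Loc P)) (ℓ ℓ' : Loc P) (σ σ' : State V) →
      Step P t (ℓ , σ) (ℓ' , σ') →
      (T'> t →
         (∀ i → prevVal f i ℓ σ ℤ.+ evalL σ (f i ℓ) ℤ.≥ evalL σ' (f i ℓ') ℤ.+ + 1)
         × evalL σ (f (fromℕ k) ℓ) ℤ.≥ + 0)
      × (T' t → ¬ T'> t → ∀ i → evalL σ (f i ℓ) ℤ.≥ evalL σ' (f i ℓ'))

-- Constants γ_i (γ 0 is an unused dummy value; γ 1 = 1)

γ : ℕ → ℚ
γ zero          = ℚ.1ℚ
γ (suc zero)    = ℚ.1ℚ
γ (suc (suc j)) =
  (+ 2 ℚ./ 1) ℚ.+ γ (suc j) ℚ.* (+ 1 ℚ./ suc j)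
    ℚ.+ ℚ._/_ (+ 1) ((suc j) !) {{(suc j) !≢0}}

maxZ : {d : ℕ} → (Fin d → ℤ) → ℤ
maxZ {zero}  x = + 0
maxZ {suc d} x = x Fin.zero ⊔ maxZ (λ i → x (Fin.suc i))

β : {V : Set} (P : Program V) {d : ℕ} → LinFun P d → Loc P → State V → ℚ
β P {d} f ℓ σ =
  ℚ.1ℚ ℚ.+ ((+ (d !) ℚ./ 1) ℚ.* γ d ℚ.* (maxZ (λ i → evalL σ (f i ℓ)) ℚ./ 1))

-- Put m = max{0, σ(f₁(ℓ)), …, σ(f_d(ℓ))}. Conditions (a) and (b) keep every value σ'(f_i(ℓ')) reached
-- after n decreasing steps below b_i(n), where b_0 = 0, b_i(0) = m and b_i(n+1) = b_{i-1}(n) + b_i(n) - 1.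
-- Pascal's rule solves this recurrence: b_i(n) = (m - 1)·Σ_{j<i} C(n,j) + 1 - C(n,i). Because
-- C(n,j+1)/C(n,j) = (n-j)/(j+1) ≥ 2m + 1 once n ≥ (2m + 2)(j + 1), for n ≥ β the top coefficient C(n,i)
-- dominates 2m·Σ_{j<i} C(n,j), so every b_i(n) is negative. Finally (j-1)!·γ_j is a natural number, which
-- makes β = 1 + d·((d-1)!·γ_d)·m a natural number.
module Submission where

open import Defs
open import Data.Nat as ℕ using (ℕ; suc)
open import Data.Integer as ℤ using (+_)
open import Data.Rational as ℚ using (ℚ)
open import Data.List using (List; [])
open import Data.List.Membership.Propositional using (_∈_)
open import Data.List.Relation.Unary.All using (All)
open import Data.Product using (Σ; _×_; _,_)
open import Relation.Nullary using (¬_)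
open import Relation.Binary.PropositionalEquality using (_≡_; _≢_)
open import Relation.Binary.Construct.Closure.ReflexiveTransitive using (Star)

open import Data.Fin using (Fin; toℕ; inject₁)
import Data.Fin.Properties as FinP
open import Data.Integer using (ℤ; 0ℤ; 1ℤ)
import Data.Integer.Properties as ℤP
import Data.Integer.Tactic.RingSolver as ℤ-Ring
open import Data.List using (_∷_)
open import Data.Nat using (zero; _+_; _*_; _≤_; _<_; z≤n; s≤s; _!)
open import Data.Nat.Combinatorics using (_C_; nC1≡n; nCk+nC[k+1]≡[n+1]C[k+1])
import Data.Nat.Properties as ℕP
import Data.Nat.Tactic.RingSolver as ℕ-Ring
open import Algebra.Properties.CommutativeSemigroup ℕP.+-commutativeSemigroup using (interchange)
open import Data.Product using (proj₁; proj₂)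
open import Data.Rational using (fromℚᵘ; toℚᵘ; 1ℚ)
import Data.Rational.Properties as ℚP
open import Data.Rational.Solver renaming (module +-*-Solver to ℚ-Solver)
import Data.Rational.Unnormalised as ℚᵘ
import Data.Rational.Unnormalised.Properties as ℚᵘP
open import Function using (id; _∘_)
open import Relation.Binary.Construct.Closure.ReflexiveTransitive using (fold)
open import Relation.Binary.PropositionalEquality
  using (refl; sym; trans; cong; cong₂; subst; subst₂; module ≡-Reasoning)

fromℚᵘ-homo-+ : ∀ p q → fromℚᵘ (p ℚᵘ.+ q) ≡ fromℚᵘ p ℚ.+ fromℚᵘ q
fromℚᵘ-homo-+ p q = ℚP.toℚᵘ-injective (begin
  toℚᵘ (fromℚᵘ (p ℚᵘ.+ q))
    ≈⟨ ℚP.toℚᵘ-fromℚᵘ (p ℚᵘ.+ q) ⟩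
  p ℚᵘ.+ q
    ≈⟨ ℚᵘP.+-cong (ℚᵘP.≃-sym (ℚP.toℚᵘ-fromℚᵘ p)) (ℚᵘP.≃-sym (ℚP.toℚᵘ-fromℚᵘ q)) ⟩
  toℚᵘ (fromℚᵘ p) ℚᵘ.+ toℚᵘ (fromℚᵘ q)
    ≈⟨ ℚᵘP.≃-sym (ℚP.toℚᵘ-homo-+ (fromℚᵘ p) (fromℚᵘ q)) ⟩
  toℚᵘ (fromℚᵘ p ℚ.+ fromℚᵘ q) ∎)
  where open ℚᵘP.≃-Reasoning

fromℚᵘ-homo-* : ∀ p q → fromℚᵘ (p ℚᵘ.* q) ≡ fromℚᵘ p ℚ.* fromℚᵘ q
fromℚᵘ-homo-* p q = ℚP.toℚᵘ-injective (begin
  toℚᵘ (fromℚᵘ (p ℚᵘ.* q))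
    ≈⟨ ℚP.toℚᵘ-fromℚᵘ (p ℚᵘ.* q) ⟩
  p ℚᵘ.* q
    ≈⟨ ℚᵘP.*-cong (ℚᵘP.≃-sym (ℚP.toℚᵘ-fromℚᵘ p)) (ℚᵘP.≃-sym (ℚP.toℚᵘ-fromℚᵘ q)) ⟩
  toℚᵘ (fromℚᵘ p) ℚᵘ.* toℚᵘ (fromℚᵘ q)
    ≈⟨ ℚᵘP.≃-sym (ℚP.toℚᵘ-homo-* (fromℚᵘ p) (fromℚᵘ q)) ⟩
  toℚᵘ (fromℚᵘ p ℚ.* fromℚᵘ q) ∎)
  where open ℚᵘP.≃-Reasoning

fromℕ : ℕ → ℚ
fromℕ n = + n ℚ./ 1

-- fromℕ n reduces to fromℚᵘ (ι n), so identities for fromℕ can be proved on unnormalised rationals.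
ι : ℕ → ℚᵘ.ℚᵘ
ι n = ℚᵘ.mkℚᵘ (+ n) 0

ι-homo-+ : ∀ a b → ι (a + b) ℚᵘ.≃ ι a ℚᵘ.+ ι b
ι-homo-+ a b = ℚᵘ.*≡* (trans (cong (ℤ._* 1ℤ) (ℤP.pos-+ a b)) (unit (+ a) (+ b)))
  where
  unit : ∀ x y → (x ℤ.+ y) ℤ.* 1ℤ ≡ (x ℤ.* 1ℤ ℤ.+ y ℤ.* 1ℤ) ℤ.* 1ℤ
  unit = ℤ-Ring.solve-∀

ι-homo-* : ∀ a b → ι (a * b) ℚᵘ.≃ ι a ℚᵘ.* ι b
ι-homo-* a b = ℚᵘ.*≡* (cong (ℤ._* 1ℤ) (ℤP.pos-* a b))

ι-*-inverse : ∀ n → ι (suc n) ℚᵘ.* ℚᵘ.mkℚᵘ 1ℤ n ℚᵘ.≃ ℚᵘ.1ℚᵘ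
ι-*-inverse n = ℚᵘ.*≡* (cong (λ x → + suc x) (ℕ-Ring.solve (n ∷ [])))

fromℕ-homo-+ : ∀ a b → fromℕ (a + b) ≡ fromℕ a ℚ.+ fromℕ b
fromℕ-homo-+ a b = trans (ℚP.fromℚᵘ-cong (ι-homo-+ a b)) (fromℚᵘ-homo-+ (ι a) (ι b))

fromℕ-homo-* : ∀ a b → fromℕ (a * b) ≡ fromℕ a ℚ.* fromℕ b
fromℕ-homo-* a b = trans (ℚP.fromℚᵘ-cong (ι-homo-* a b)) (fromℚᵘ-homo-* (ι a) (ι b))

fromℕ-*-inverse : ∀ n .{{_ : ℕ.NonZero n}} → fromℕ n ℚ.* (+ 1 ℚ./ n) ≡ 1ℚ
fromℕ-*-inverse (suc n) = begin
  fromℕ (suc n) ℚ.* fromℚᵘ (ℚᵘ.mkℚᵘ 1ℤ n)  ≡⟨ sym (fromℚᵘ-homo-* (ι (suc n)) (ℚᵘ.mkℚᵘ 1ℤ n)) ⟩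
  fromℚᵘ (ι (suc n) ℚᵘ.* ℚᵘ.mkℚᵘ 1ℤ n)    ≡⟨ ℚP.fromℚᵘ-cong (ι-*-inverse n) ⟩
  1ℚ                                       ∎
  where open ≡-Reasoning

fromℕ-cancel-≤ : ∀ {a b} → fromℕ a ℚ.≤ fromℕ b → a ≤ b
fromℕ-cancel-≤ {a} {b} a≤b =
  ℤP.drop‿+≤+ (subst₂ ℤ._≤_ (ℤP.*-identityʳ (+ a)) (ℤP.*-identityʳ (+ b)) (ℚᵘP.drop-*≤* ιa≤ιb))
  where
  ιa≤ιb : ι a ℚᵘ.≤ ι b
  ιa≤ιb = ℚᵘP.≤-respʳ-≃ (ℚP.toℚᵘ-fromℚᵘ (ι b))
            (ℚᵘP.≤-respˡ-≃ (ℚP.toℚᵘ-fromℚᵘ (ι a)) (ℚP.toℚᵘ-mono-≤ a≤b))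

γ-pos : ∀ i → 1 ≤ i → ℚ.0ℚ ℚ.< γ i
γ-pos (suc zero)    _ = ℚP.positive⁻¹ 1ℚ
γ-pos (suc (suc j)) _ = ℚP.positive⁻¹ (γ (2 + j))
  where
  u v : ℚ
  u = + 1 ℚ./ suc j
  v = ℚ._/_ (+ 1) (suc j !) {{suc j ℕP.!≢0}}
  instance
    2>0 : ℚ.Positive (fromℕ 2)
    2>0 = ℚP.normalize-pos 2 1
    u>0 : ℚ.Positive u
    u>0 = ℚP.normalize-pos 1 (suc j)
    v>0 : ℚ.Positive v
    v>0 = ℚP.normalize-pos 1 (suc j !) {{suc j ℕP.!≢0}}
    γ>0 : ℚ.Positive (γ (suc j))
    γ>0 = ℚ.positive (γ-pos (suc j) (s≤s z≤n))
    γu>0 : ℚ.Positive (γ (suc j) ℚ.* u)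
    γu>0 = ℚP.pos*pos⇒pos (γ (suc j)) u
    2+γu>0 : ℚ.Positive (fromℕ 2 ℚ.+ γ (suc j) ℚ.* u)
    2+γu>0 = ℚP.pos+pos⇒pos (fromℕ 2) (γ (suc j) ℚ.* u)
    2+γu+v>0 : ℚ.Positive (γ (2 + j))
    2+γu+v>0 = ℚP.pos+pos⇒pos (fromℕ 2 ℚ.+ γ (suc j) ℚ.* u) v

scaledγ : ℕ → ℕ
scaledγ zero    = 1
scaledγ (suc j) = 2 * suc j ! + scaledγ j + 1

1≤scaledγ : ∀ j → 1 ≤ scaledγ j
1≤scaledγ zero    = ℕP.≤-refl
1≤scaledγ (suc j) = ℕP.m≤n+m 1 _

4≤scaledγ[1+j] : ∀ j → 4 ≤ scaledγ (suc j)
4≤scaledγ[1+j] j =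
  ℕP.+-mono-≤ (ℕP.+-mono-≤ (ℕP.*-monoʳ-≤ 2 (ℕP.1≤n! (suc j))) (1≤scaledγ j)) (ℕP.≤-refl {1})

!*γ≡scaledγ : ∀ j → fromℕ (j !) ℚ.* γ (suc j) ≡ fromℕ (scaledγ j)
!*γ≡scaledγ zero    = refl
!*γ≡scaledγ (suc j) = begin
  fromℕ (suc j * j !) ℚ.* γ (2 + j)
    ≡⟨ cong (ℚ._* γ (2 + j)) (fromℕ-homo-* (suc j) (j !)) ⟩
  (B ℚ.* A) ℚ.* (two ℚ.+ g ℚ.* u ℚ.+ v)
    ≡⟨ expand B A g u v two ⟩
  two ℚ.* (B ℚ.* A) ℚ.+ (B ℚ.* u) ℚ.* (A ℚ.* g) ℚ.+ (B ℚ.* A) ℚ.* v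
    ≡⟨ cong₂ (λ x y → two ℚ.* x ℚ.+ y ℚ.* (A ℚ.* g) ℚ.+ x ℚ.* v) BA≡F (fromℕ-*-inverse (suc j)) ⟩
  two ℚ.* F ℚ.+ 1ℚ ℚ.* (A ℚ.* g) ℚ.+ F ℚ.* v
    ≡⟨ cong₂ (λ x y → two ℚ.* F ℚ.+ x ℚ.+ y) (trans (ℚP.*-identityˡ (A ℚ.* g)) (!*γ≡scaledγ j))
             (fromℕ-*-inverse (suc j !) {{suc j ℕP.!≢0}}) ⟩
  two ℚ.* F ℚ.+ fromℕ (scaledγ j) ℚ.+ 1ℚ
    ≡⟨ sym (cong (λ x → x ℚ.+ fromℕ (scaledγ j) ℚ.+ 1ℚ) (fromℕ-homo-* 2 (suc j !))) ⟩
  fromℕ (2 * suc j !) ℚ.+ fromℕ (scaledγ j) ℚ.+ fromℕ 1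
    ≡⟨ sym (cong (ℚ._+ fromℕ 1) (fromℕ-homo-+ (2 * suc j !) (scaledγ j))) ⟩
  fromℕ (2 * suc j ! + scaledγ j) ℚ.+ fromℕ 1
    ≡⟨ sym (fromℕ-homo-+ (2 * suc j ! + scaledγ j) 1) ⟩
  fromℕ (scaledγ (suc j)) ∎
  where
  open ≡-Reasoning
  A B F g u v two : ℚ
  A = fromℕ (j !)
  B = fromℕ (suc j)
  F = fromℕ (suc j !)
  g = γ (suc j)
  u = + 1 ℚ./ suc j
  v = ℚ._/_ (+ 1) (suc j !) {{suc j ℕP.!≢0}}
  two = fromℕ 2
  BA≡F : B ℚ.* A ≡ F
  BA≡F = sym (fromℕ-homo-* (suc j) (j !))
  expand : ∀ B A g u v two → (B ℚ.* A) ℚ.* (two ℚ.+ g ℚ.* u ℚ.+ v)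
                             ≡ two ℚ.* (B ℚ.* A) ℚ.+ (B ℚ.* u) ℚ.* (A ℚ.* g) ℚ.+ (B ℚ.* A) ℚ.* v
  expand = solve 6 (λ B A g u v two → (B :* A) :* (two :+ g :* u :+ v)
                                    := two :* (B :* A) :+ (B :* u) :* (A :* g) :+ (B :* A) :* v) refl
    where open ℚ-Solver

[1+k]!*γ[1+k]≡[1+k]*scaledγ : ∀ k → fromℕ (suc k !) ℚ.* γ (suc k) ≡ fromℕ (suc k * scaledγ k)
[1+k]!*γ[1+k]≡[1+k]*scaledγ k = begin
  fromℕ (suc k * k !) ℚ.* γ (suc k)
    ≡⟨ cong (ℚ._* γ (suc k)) (fromℕ-homo-* (suc k) (k !)) ⟩
  fromℕ (suc k) ℚ.* fromℕ (k !) ℚ.* γ (suc k)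
    ≡⟨ ℚP.*-assoc (fromℕ (suc k)) (fromℕ (k !)) (γ (suc k)) ⟩
  fromℕ (suc k) ℚ.* (fromℕ (k !) ℚ.* γ (suc k))
    ≡⟨ cong (fromℕ (suc k) ℚ.*_) (!*γ≡scaledγ k) ⟩
  fromℕ (suc k) ℚ.* fromℕ (scaledγ k)
    ≡⟨ sym (fromℕ-homo-* (suc k) (scaledγ k)) ⟩
  fromℕ (suc k * scaledγ k) ∎
  where open ≡-Reasoning

maxZ-upper : ∀ {d} (x : Fin d → ℤ) i → x i ℤ.≤ maxZ x
maxZ-upper x Fin.zero    = ℤP.i≤i⊔j (x Fin.zero) _
maxZ-upper x (Fin.suc i) = ℤP.i≤j⇒i≤k⊔j (x Fin.zero) (maxZ-upper (x ∘ Fin.suc) i)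

maxZ-nonneg : ∀ {d} (x : Fin d → ℤ) → 0ℤ ℤ.≤ maxZ x
maxZ-nonneg {zero}  x = ℤP.≤-refl
maxZ-nonneg {suc d} x = ℤP.i≤j⇒i≤k⊔j (x Fin.zero) (maxZ-nonneg (x ∘ Fin.suc))

β≡fromℕ : ∀ {V} (P : Program V) {k} (f : LinFun P (suc k)) ℓ σ m →
          maxZ (λ i → evalL σ (f i ℓ)) ≡ + m → β P f ℓ σ ≡ fromℕ (suc (suc k * scaledγ k * m))
β≡fromℕ P {k} f ℓ σ m max≡m = begin
  1ℚ ℚ.+ fromℕ (suc k !) ℚ.* γ (suc k) ℚ.* (maxZ (λ i → evalL σ (f i ℓ)) ℚ./ 1)
    ≡⟨ cong₂ (λ x y → 1ℚ ℚ.+ x ℚ.* (y ℚ./ 1)) ([1+k]!*γ[1+k]≡[1+k]*scaledγ k) max≡m ⟩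
  fromℕ 1 ℚ.+ fromℕ (suc k * scaledγ k) ℚ.* fromℕ m
    ≡⟨ sym (cong (fromℕ 1 ℚ.+_) (fromℕ-homo-* (suc k * scaledγ k) m)) ⟩
  fromℕ 1 ℚ.+ fromℕ (suc k * scaledγ k * m)
    ≡⟨ sym (fromℕ-homo-+ 1 (suc k * scaledγ k * m)) ⟩
  fromℕ (suc (suc k * scaledγ k * m)) ∎
  where open ≡-Reasoning

[1+i]*nC[1+i]+i*nCi≡n*nCi : ∀ n i → suc i * (n C suc i) + i * (n C i) ≡ n * (n C i)
[1+i]*nC[1+i]+i*nCi≡n*nCi zero    zero    = refl
[1+i]*nC[1+i]+i*nCi≡n*nCi zero    (suc i) = cong₂ _+_ (ℕP.*-zeroʳ (2 + i)) (ℕP.*-zeroʳ (1 + i))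
[1+i]*nC[1+i]+i*nCi≡n*nCi (suc n) zero    = begin
  1 * (suc n C 1) + 0 ≡⟨ cong (λ x → 1 * x + 0) (nC1≡n (suc n)) ⟩
  1 * suc n + 0       ≡⟨ ℕ-Ring.solve (n ∷ []) ⟩
  suc n * 1           ∎
  where open ≡-Reasoning
[1+i]*nC[1+i]+i*nCi≡n*nCi (suc n) (suc i) = begin
  (2 + i) * (suc n C (2 + i)) + (1 + i) * (suc n C (1 + i))
    ≡⟨ sym (cong₂ (λ x y → (2 + i) * x + (1 + i) * y)
                  (nCk+nC[k+1]≡[n+1]C[k+1] n (1 + i)) (nCk+nC[k+1]≡[n+1]C[k+1] n i)) ⟩
  (2 + i) * (b + c) + (1 + i) * (a + b)
    ≡⟨ regroup i a b c ⟩
  ((2 + i) * c + (1 + i) * b) + b + ((1 + i) * b + i * a) + a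
    ≡⟨ cong₂ (λ x y → x + b + y + a)
             ([1+i]*nC[1+i]+i*nCi≡n*nCi n (suc i)) ([1+i]*nC[1+i]+i*nCi≡n*nCi n i) ⟩
  n * b + b + n * a + a
    ≡⟨ collect n a b ⟩
  suc n * (a + b)
    ≡⟨ cong (suc n *_) (nCk+nC[k+1]≡[n+1]C[k+1] n i) ⟩
  suc n * (suc n C suc i) ∎
  where
  open ≡-Reasoning
  a b c : ℕ
  a = n C i
  b = n C suc i
  c = n C (2 + i)
  regroup : ∀ i a b c → (2 + i) * (b + c) + (1 + i) * (a + b)
                        ≡ ((2 + i) * c + (1 + i) * b) + b + ((1 + i) * b + i * a) + a
  regroup = ℕ-Ring.solve-∀
  collect : ∀ n a b → n * b + b + n * a + a ≡ suc n * (a + b)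
  collect = ℕ-Ring.solve-∀

c*nCi≤nC[1+i] : ∀ c n i → suc c * suc i ≤ n → c * (n C i) ≤ n C suc i
c*nCi≤nC[1+i] c n i h = ℕP.*-cancelˡ-≤ (suc i) (ℕP.+-cancelʳ-≤ (suc i * a) _ _ (begin
  suc i * (c * a) + suc i * a ≡⟨ collect c i a ⟩
  suc c * suc i * a           ≤⟨ ℕP.*-monoˡ-≤ a h ⟩
  n * a                       ≡⟨ sym ([1+i]*nC[1+i]+i*nCi≡n*nCi n i) ⟩
  suc i * b + i * a           ≤⟨ ℕP.+-monoʳ-≤ (suc i * b) (ℕP.*-monoˡ-≤ a (ℕP.n≤1+n i)) ⟩
  suc i * b + suc i * a       ∎))
  where
  open ℕP.≤-Reasoning
  a b : ℕ
  a = n C i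
  b = n C suc i
  collect : ∀ c i a → suc i * (c * a) + suc i * a ≡ suc c * suc i * a
  collect = ℕ-Ring.solve-∀

ΣC : ℕ → ℕ → ℕ
ΣC n zero    = 0
ΣC n (suc i) = ΣC n i + n C i

c*ΣC≤nCi : ∀ c n i → (2 + c) * i ≤ n → c * ΣC n i ≤ n C i
c*ΣC≤nCi c n zero    _ = ℕP.≤-trans (ℕP.≤-reflexive (ℕP.*-zeroʳ c)) z≤n
c*ΣC≤nCi c n (suc i) h = begin
  c * (ΣC n i + a)    ≡⟨ ℕP.*-distribˡ-+ c (ΣC n i) a ⟩
  c * ΣC n i + c * a  ≤⟨ ℕP.+-monoˡ-≤ (c * a) (c*ΣC≤nCi c n i h′) ⟩
  a + c * a           ≤⟨ c*nCi≤nC[1+i] (suc c) n i h ⟩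
  n C suc i           ∎
  where
  open ℕP.≤-Reasoning
  a : ℕ
  a = n C i
  h′ : (2 + c) * i ≤ n
  h′ = ℕP.≤-trans (ℕP.*-monoʳ-≤ (2 + c) (ℕP.n≤1+n i)) h

ΣC-suc : ∀ n i → ΣC (suc n) (suc i) ≡ ΣC n i + ΣC n (suc i)
ΣC-suc n zero    = refl
ΣC-suc n (suc i) = begin
  ΣC (suc n) (suc i) + (suc n C suc i)
    ≡⟨ cong₂ _+_ (ΣC-suc n i) (sym (nCk+nC[k+1]≡[n+1]C[k+1] n i)) ⟩
  (ΣC n i + ΣC n (suc i)) + (n C i + n C suc i)
    ≡⟨ interchange (ΣC n i) (ΣC n (suc i)) (n C i) (n C suc i) ⟩
  (ΣC n i + n C i) + (ΣC n (suc i) + n C suc i) ∎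
  where open ≡-Reasoning

ΣC-zero : ∀ i → ΣC 0 (suc i) ≡ 1
ΣC-zero zero    = refl
ΣC-zero (suc i) = trans (ℕP.+-identityʳ (ΣC 0 (suc i))) (ΣC-zero i)

ΣC-mono : ∀ n {i j} → i ≤ j → ΣC n i ≤ ΣC n j
ΣC-mono n i≤j = go (ℕP.≤⇒≤′ i≤j)
  where
  go : ∀ {i j} → i ℕ.≤′ j → ΣC n i ≤ ΣC n j
  go (ℕ.≤′-reflexive refl) = ℕP.≤-refl
  go (ℕ.≤′-step i≤′j)      = ℕP.≤-trans (go i≤′j) (ℕP.m≤m+n _ _)

1≤ΣC : ∀ n i → 1 ≤ ΣC n (suc i)
1≤ΣC n i = ΣC-mono n (s≤s (z≤n {i}))

-- bound m i n bounds f_i after n decreasing steps when f_1, …, f_d start at most m; level 0 is f_0 = 0.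
bound : ℕ → ℕ → ℕ → ℤ
bound m zero    n       = 0ℤ
bound m (suc i) zero    = + m
bound m (suc i) (suc n) = ℤ.pred (bound m i n ℤ.+ bound m (suc i) n)

bound-closed : ∀ m i n → bound m i n ≡ (+ m ℤ.- 1ℤ) ℤ.* + ΣC n i ℤ.+ 1ℤ ℤ.- + (n C i)
bound-closed m zero    n       = base (+ m)
  where
  base : ∀ x → 0ℤ ≡ (x ℤ.- 1ℤ) ℤ.* 0ℤ ℤ.+ 1ℤ ℤ.- 1ℤ
  base = ℤ-Ring.solve-∀
bound-closed m (suc i) zero    = begin
  + m
    ≡⟨ start (+ m) ⟩
  (+ m ℤ.- 1ℤ) ℤ.* 1ℤ ℤ.+ 1ℤ ℤ.- 0ℤ
    ≡⟨ cong (λ s → (+ m ℤ.- 1ℤ) ℤ.* + s ℤ.+ 1ℤ ℤ.- 0ℤ) (sym (ΣC-zero i)) ⟩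
  (+ m ℤ.- 1ℤ) ℤ.* + ΣC 0 (suc i) ℤ.+ 1ℤ ℤ.- + (0 C suc i) ∎
  where
  open ≡-Reasoning
  start : ∀ x → x ≡ (x ℤ.- 1ℤ) ℤ.* 1ℤ ℤ.+ 1ℤ ℤ.- 0ℤ
  start = ℤ-Ring.solve-∀
bound-closed m (suc i) (suc n) = begin
  ℤ.pred (bound m i n ℤ.+ bound m (suc i) n)
    ≡⟨ cong₂ (λ x y → ℤ.pred (x ℤ.+ y)) (bound-closed m i n) (bound-closed m (suc i) n) ⟩
  ℤ.pred ((μ ℤ.* + s ℤ.+ 1ℤ ℤ.- + a) ℤ.+ (μ ℤ.* + s′ ℤ.+ 1ℤ ℤ.- + b))
    ≡⟨ collect μ (+ s) (+ s′) (+ a) (+ b) ⟩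
  μ ℤ.* (+ s ℤ.+ + s′) ℤ.+ 1ℤ ℤ.- (+ a ℤ.+ + b)
    ≡⟨ sym (cong₂ (λ x y → μ ℤ.* x ℤ.+ 1ℤ ℤ.- y) (ℤP.pos-+ s s′) (ℤP.pos-+ a b)) ⟩
  μ ℤ.* + (s + s′) ℤ.+ 1ℤ ℤ.- + (a + b)
    ≡⟨ sym (cong₂ (λ x y → μ ℤ.* + x ℤ.+ 1ℤ ℤ.- + y) (ΣC-suc n i) (sym (nCk+nC[k+1]≡[n+1]C[k+1] n i))) ⟩
  μ ℤ.* + ΣC (suc n) (suc i) ℤ.+ 1ℤ ℤ.- + (suc n C suc i) ∎
  where
  open ≡-Reasoning
  μ : ℤ
  μ = + m ℤ.- 1ℤ
  s s′ a b : ℕ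
  s  = ΣC n i
  s′ = ΣC n (suc i)
  a  = n C i
  b  = n C suc i
  collect : ∀ μ s s′ a b → ℤ.-1ℤ ℤ.+ ((μ ℤ.* s ℤ.+ 1ℤ ℤ.- a) ℤ.+ (μ ℤ.* s′ ℤ.+ 1ℤ ℤ.- b))
                           ≡ μ ℤ.* (s ℤ.+ s′) ℤ.+ 1ℤ ℤ.- (a ℤ.+ b)
  collect = ℤ-Ring.solve-∀

bound-negative : ∀ m i n → m * ΣC n i + 1 < n C i + ΣC n i → bound m i n ℤ.< 0ℤ
bound-negative m i n lt = begin-strict
  bound m i n                              ≡⟨ bound-closed m i n ⟩
  (+ m ℤ.- 1ℤ) ℤ.* + s ℤ.+ 1ℤ ℤ.- + a    ≡⟨ regroup (+ m) (+ s) (+ a) ⟩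
  + m ℤ.* + s ℤ.+ 1ℤ ℤ.- (+ a ℤ.+ + s)    ≡⟨ sym (cong₂ (λ x y → x ℤ.+ 1ℤ ℤ.- y) (ℤP.pos-* m s) (ℤP.pos-+ a s)) ⟩
  + (m * s) ℤ.+ 1ℤ ℤ.- + (a + s)           ≡⟨ cong (ℤ._- + (a + s)) (sym (ℤP.pos-+ (m * s) 1)) ⟩
  + (m * s + 1) ℤ.- + (a + s)              ≡⟨ ℤP.m-n≡m⊖n (m * s + 1) (a + s) ⟩
  (m * s + 1) ℤ.⊖ (a + s)                  <⟨ ℤP.⊖-monoʳ->-< (m * s + 1) lt ⟩
  (m * s + 1) ℤ.⊖ (m * s + 1)              ≡⟨ ℤP.n⊖n≡0 (m * s + 1) ⟩
  0ℤ                                       ∎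
  where
  open ℤP.≤-Reasoning
  s a : ℕ
  s = ΣC n i
  a = n C i
  regroup : ∀ x s a → (x ℤ.- 1ℤ) ℤ.* s ℤ.+ 1ℤ ℤ.- a ≡ x ℤ.* s ℤ.+ 1ℤ ℤ.- (a ℤ.+ s)
  regroup = ℤ-Ring.solve-∀

bound-negative-past-threshold : ∀ k m n i → i < suc k → suc (suc k * scaledγ k * m) ≤ n →
                                bound m (suc i) n ℤ.< 0ℤ
bound-negative-past-threshold k m n zero _ β≤n = bound-negative m 1 n (begin-strict
  m * 1 + 1  ≡⟨ cong (_+ 1) (ℕP.*-identityʳ m) ⟩
  m + 1      <⟨ ℕP.+-monoˡ-< 1 m<n ⟩
  n + 1      ≡⟨ cong (_+ 1) (sym (nC1≡n n)) ⟩
  n C 1 + 1  ∎)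
  where
  open ℕP.≤-Reasoning
  m<n : m < n
  m<n = begin-strict
    m                      ≡⟨ sym (ℕP.*-identityˡ m) ⟩
    1 * m                  ≤⟨ ℕP.*-monoˡ-≤ m (ℕP.*-mono-≤ (s≤s (z≤n {k})) (1≤scaledγ k)) ⟩
    suc k * scaledγ k * m  <⟨ β≤n ⟩
    n                      ∎
bound-negative-past-threshold zero    m    n (suc i) (s≤s ()) _
bound-negative-past-threshold (suc k) zero n (suc i) _ β≤n = bound-negative 0 (2 + i) n (begin-strict
  1                           <⟨ s≤s (ℕP.≤-trans (s≤s z≤n) β≤n) ⟩
  suc n                       ≡⟨ cong suc (sym (nC1≡n n)) ⟩
  ΣC n 2                      ≤⟨ ΣC-mono n {2} {2 + i} (s≤s (s≤s z≤n)) ⟩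
  ΣC n (2 + i)                ≤⟨ ℕP.m≤n+m (ΣC n (2 + i)) (n C (2 + i)) ⟩
  n C (2 + i) + ΣC n (2 + i)  ∎)
  where open ℕP.≤-Reasoning
bound-negative-past-threshold (suc k) (suc m) n (suc i) i<d β≤n = bound-negative M (2 + i) n (begin-strict
  M * S + 1        ≤⟨ ℕP.+-monoʳ-≤ (M * S) (ℕP.*-mono-≤ (s≤s (z≤n {m})) (1≤ΣC n (suc i))) ⟩
  M * S + M * S    ≡⟨ double M S ⟩
  2 * M * S        ≤⟨ c*ΣC≤nCi (2 * M) n (2 + i) threshold ⟩
  n C (2 + i)      <⟨ ℕP.m<m+n (n C (2 + i)) (1≤ΣC n (suc i)) ⟩
  n C (2 + i) + S  ∎)
  where
  open ℕP.≤-Reasoning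
  M S d : ℕ
  M = suc m
  S = ΣC n (2 + i)
  d = suc (suc k)
  double : ∀ M S → M * S + M * S ≡ 2 * M * S
  double = ℕ-Ring.solve-∀
  double′ : ∀ M → 2 * M + 2 * M ≡ 4 * M
  double′ = ℕ-Ring.solve-∀
  rotate : ∀ a b c → a * b * c ≡ c * a * b
  rotate = ℕ-Ring.solve-∀
  threshold : (2 + 2 * M) * (2 + i) ≤ n
  threshold = begin
    (2 + 2 * M) * (2 + i)    ≤⟨ ℕP.*-monoʳ-≤ (2 + 2 * M) i<d ⟩
    (2 + 2 * M) * d          ≤⟨ ℕP.*-monoˡ-≤ d (ℕP.+-monoˡ-≤ (2 * M) (ℕP.*-monoʳ-≤ 2 (s≤s (z≤n {m})))) ⟩
    (2 * M + 2 * M) * d      ≡⟨ cong (_* d) (double′ M) ⟩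
    4 * M * d                ≤⟨ ℕP.*-monoˡ-≤ d (ℕP.*-monoˡ-≤ M (4≤scaledγ[1+j] k)) ⟩
    scaledγ (suc k) * M * d  ≡⟨ rotate (scaledγ (suc k)) M d ⟩
    d * scaledγ (suc k) * M  <⟨ β≤n ⟩
    n                        ∎

module _ {V : Set} (P : Program V) {k : ℕ} (f : LinFun P (suc k))
         {Strict Allowed : Transition V (Loc P) → Set} (mrf : IsMΦRF P f Strict Allowed)
         (m : ℕ) where

  NonStrictStep : Config P → Config P → Set
  NonStrictStep = StepSet P (λ t → Allowed t × ¬ Strict t)

  Round : Config P → Config P → Set
  Round = Star NonStrictStep ∘ᴿ StepSet P Strict

  BoundedAfter : ℕ → Config P → Set
  BoundedAfter n (ℓ , σ) = ∀ i → evalL σ (f i ℓ) ℤ.≤ bound m (suc (toℕ i)) n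

  bounded-nonstrict : ∀ n {c c′} → NonStrictStep c c′ → BoundedAfter n c → BoundedAfter n c′
  bounded-nonstrict n {ℓ , σ} {ℓ′ , σ′} (t , (allowed , not-strict) , step) bd i =
    ℤP.≤-trans (proj₂ (mrf t ℓ ℓ′ σ σ′ step) allowed not-strict i) (bd i)

  bounded-nonstricts : ∀ n {c c′} → Star NonStrictStep c c′ → BoundedAfter n c → BoundedAfter n c′
  bounded-nonstricts n =
    fold (λ c c′ → BoundedAfter n c → BoundedAfter n c′) (λ s bd → bd ∘ bounded-nonstrict n s) id

  bounded-strict : ∀ n {c c′} → StepSet P Strict c c′ → BoundedAfter n c → BoundedAfter (suc n) c′
  bounded-strict n {ℓ , σ} {ℓ′ , σ′} (t , strict , step) bd i =
    ℤP.i<j⇒i≤pred[j] (ℤP.suc[i]≤j⇒i<j (begin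
      1ℤ ℤ.+ evalL σ′ (f i ℓ′)                        ≡⟨ ℤP.+-comm 1ℤ (evalL σ′ (f i ℓ′)) ⟩
      evalL σ′ (f i ℓ′) ℤ.+ 1ℤ                        ≤⟨ proj₁ (proj₁ (mrf t ℓ ℓ′ σ σ′ step) strict) i ⟩
      prevVal P f i ℓ σ ℤ.+ evalL σ (f i ℓ)           ≤⟨ ℤP.+-mono-≤ (prev-bounded i) (bd i) ⟩
      bound m (toℕ i) n ℤ.+ bound m (suc (toℕ i)) n  ∎))
    where
    open ℤP.≤-Reasoning hiding (strict)
    prev-bounded : ∀ i → prevVal P f i ℓ σ ℤ.≤ bound m (toℕ i) n
    prev-bounded Fin.zero    = ℤP.≤-refl
    prev-bounded (Fin.suc j) =
      subst (λ x → evalL σ (f (inject₁ j) ℓ) ℤ.≤ bound m (suc x) n) (FinP.toℕ-inject₁ j) (bd (inject₁ j))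

  bounded-round : ∀ n {c c′} → Round c c′ → BoundedAfter n c → BoundedAfter (suc n) c′
  bounded-round n (_ , steps , strict) = bounded-strict n strict ∘ bounded-nonstricts n steps

  bounded-rounds : ∀ j n {c c′} → (Round ^ᴿ n) c c′ → BoundedAfter j c → BoundedAfter (j + n) c′
  bounded-rounds j zero    {c} refl = subst (λ x → BoundedAfter x c) (sym (ℕP.+-identityʳ j))
  bounded-rounds j (suc n) {c′ = c′} (_ , round , rounds) =
    subst (λ x → BoundedAfter x c′) (sym (ℕP.+-suc j n))
      ∘ bounded-rounds (suc j) n rounds ∘ bounded-round j round

-- The entry-location hypothesis and the side conditions on 𝒯'> are not needed: the bound holds from any state.
lemma18 : {V : Set} (P : Program V) (T'> T' : List (Transition V (Loc P))) →
          T'> ≢ [] → All (_∈ T') T'> → All (_∈ T P) T' →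
          (ℓ : Loc P) → IsEntryLocation P T' ℓ →
          (σ : State V) (k : ℕ) (f : LinFun P (suc k)) →
          IsMΦRF P f (_∈ T'>) (_∈ T') →
          (∀ i → 1 ℕ.≤ i → ℚ.0ℚ ℚ.< γ i)
          × (Σ ℕ λ b → (0 ℕ.< b) × ((+ b) ℚ./ 1 ≡ β P f ℓ σ))
          × (∀ (n : ℕ) (ℓ' : Loc P) (σ' : State V) →
               β P f ℓ σ ℚ.≤ (+ n) ℚ./ 1 →
               ((Star (StepSet P (λ t → (t ∈ T') × ¬ (t ∈ T'>)))
                  ∘ᴿ StepSet P (_∈ T'>)) ^ᴿ n) (ℓ , σ) (ℓ' , σ') →
               ∀ i → evalL σ' (f i ℓ') ℤ.< + 0)
lemma18 P T'> T' _ _ _ ℓ _ σ k f mrf = γ-pos , (b , s≤s z≤n , sym β≡b) , λ n ℓ′ σ′ β≤n run i →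
  ℤP.≤-<-trans (bounded-rounds P f mrf m 0 n run initially i)
    (bound-negative-past-threshold k m n (toℕ i) (FinP.toℕ<n i)
      (fromℕ-cancel-≤ (subst (ℚ._≤ fromℕ n) β≡b β≤n)))
  where
  x : Fin (suc k) → ℤ
  x i = evalL σ (f i ℓ)
  m : ℕ
  m = ℤ.∣ maxZ x ∣
  m≡max : + m ≡ maxZ x
  m≡max = ℤP.0≤i⇒+∣i∣≡i (maxZ-nonneg x)
  b : ℕ
  b = suc (suc k * scaledγ k * m)
  β≡b : β P f ℓ σ ≡ fromℕ b
  β≡b = β≡fromℕ P f ℓ σ m (sym m≡max)
  initially : BoundedAfter P f mrf m 0 (ℓ , σ)
  initially i = ℤP.≤-trans (maxZ-upper x i) (ℤP.≤-reflexive (sym m≡max))
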